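{- Let $s$ be a string and $k\ge 0$ an integer, and suppose $|O_k|\ge3$. Then there exist three elements $uv,u'v',u''v''\in O_k$ such that $$0<|u'|-|u|<\frac{2^k}{|O_k|-2}\qquad\text{and}\qquad 0<|u''|-|u'|<\frac{2^k}{|O_k|-2}.$$
   Context: Two strings $u,v$ over an ordered alphabet are order-isomorphic, written $u\approx v$, if $|u|=|v|$ and for all $i,j$ we have $u[i]\le u[j]$ iff $v[i]\le v[j]$. An order-preserving square (op-square) is a string $uv$ with $u\approx v$ and $u\ne v$, where $|u|=|v|$. For a string $s$ and an integer $k\ge0$, $O_k$ is the set of prefixes of $s$ that are op-squares with length in $[2^k,2^{k+1})$. Each element is written as $uv$ with left arm $u$ and right arm $v$. -}

module Defs where

open import Level using (Level)
open import Data.Nat using (ℕ; _+_; _*_; _^_; _≤_; _<_)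
open import Data.Fin using (Fin; cast)
open import Data.List using (List; length; lookup; take; drop)
open import Data.List.Relation.Binary.Pointwise using (Pointwise)
open import Data.List.Membership.Propositional using (_∈_)
open import Data.List.Relation.Unary.Unique.Propositional using (Unique)
open import Data.Product using (Σ; _×_)
open import Relation.Binary.PropositionalEquality using (_≡_)
open import Relation.Binary.Bundles using (TotalOrder)
open import Relation.Nullary using (¬_)
open import Function.Bundles using (_⇔_)

module _ {c ℓ₁ ℓ₂ : Level} (Σ' : TotalOrder c ℓ₁ ℓ₂) where
  open TotalOrder Σ' renaming (Carrier to A; _≤_ to _≤ₐ_)

  OrderIso : List A → List A → Set _
  OrderIso u v = Σ (length u ≡ length v) λ eq →
    (i j : Fin (length u)) →
      (lookup u i ≤ₐ lookup u j) ⇔ (lookup v (cast eq i) ≤ₐ lookup v (cast eq j))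

  OpSquare : List A → List A → Set _
  OpSquare u v = length u ≡ length v × OrderIso u v × ¬ Pointwise _≈_ u v

  leftArm : List A → ℕ → List A
  leftArm s m = take m s

  rightArm : List A → ℕ → List A
  rightArm s m = take m (drop m s)

  -- "The prefix of s of length 2m is an element of O_k" (m = |u| = arm length).
  -- Elements of O_k are determined by their length, hence by m.
  InO : List A → ℕ → ℕ → Set _
  InO s k m = (m + m ≤ length s) × (2 ^ k ≤ m + m) × (m + m < 2 ^ (k + 1))
            × OpSquare (leftArm s m) (rightArm s m)

  CardO : List A → ℕ → ℕ → Set _
  CardO s k N = Σ (List ℕ) λ L → Unique L × ((m : ℕ) → (m ∈ L) ⇔ InO s k m)
                × length L ≡ N

{-# OPTIONS --safe #-}
-- Sort the arm lengths x₁ < x₂ < ⋯ < x_N of O_k; they all lie in [2^(k-1), 2^k).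
-- The spans x_{i+2} − x_i of the N − 2 windows of three consecutive lengths
-- telescope to (x_{N-1} + x_N) − (x₁ + x₂) < 2·2^k − 2^k = 2^k, so some window
-- has span below 2^k / (N − 2), and so do both of its gaps.
module Submission where

open import Defs
open import Level using (Level)
open import Data.Nat using (ℕ; suc; _+_; _*_; _∸_; _^_; _≤_; _<_; NonZero; _<?_; s≤s)
open import Data.Nat.Properties
open import Data.Nat.Tactic.RingSolver using (solve-∀)
open import Data.List using (List; []; _∷_; length)
open import Data.List.Membership.Propositional using (_∈_)
open import Data.List.Relation.Unary.All as All using (All; _∷_)
open import Data.List.Relation.Unary.AllPairs as AllPairs using ()
open import Data.List.Relation.Unary.Any using (here; there)
open import Data.List.Relation.Unary.Linked using (Linked; _∷_)
open import Data.List.Relation.Unary.Linked.Properties using (Linked⇒AllPairs; AllPairs⇒Linked)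
open import Data.List.Relation.Unary.Unique.Propositional using (Unique)
open import Data.List.Relation.Binary.Permutation.Propositional using (↭-sym; ↭⇒↭ₛ)
open import Data.List.Relation.Binary.Permutation.Propositional.Properties using (∈-resp-↭; ↭-length)
open import Data.List.Relation.Binary.Permutation.Setoid.Properties using (Unique-resp-↭)
open import Data.List.Sort ≤-decTotalOrder using (sort; sort-↭; sort-↗)
open import Data.Product using (Σ; _×_; _,_; proj₁; proj₂; uncurry)
open import Function.Bundles using (Equivalence)
open import Relation.Nullary using (yes; no; contradiction)
open import Relation.Binary.Bundles using (TotalOrder)
open import Relation.Binary.PropositionalEquality
  using (_≡_; refl; sym; trans; cong; subst; setoid; module ≡-Reasoning)

CloseTriple : ∀ {p} → (ℕ → Set p) → ℕ → ℕ → Set p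
CloseTriple P c T = Σ ℕ λ m → Σ ℕ λ m′ → Σ ℕ λ m″ →
  P m × P m′ × P m″ ×
  (m < m′) × ((m′ ∸ m) * c < T) ×
  (m′ < m″) × ((m″ ∸ m′) * c < T)

CloseTriple-map : ∀ {p q} {P : ℕ → Set p} {Q : ℕ → Set q} {c T} →
  (∀ {m} → P m → Q m) → CloseTriple P c T → CloseTriple Q c T
CloseTriple-map f (m , m′ , m″ , pm , pm′ , pm″ , gaps) = m , m′ , m″ , f pm , f pm′ , f pm″ , gaps

half-< : ∀ {m n} → m + m < n + n → m < n
half-< m+m<n+n = ≰⇒> λ n≤m → <⇒≱ m+m<n+n (+-mono-≤ n≤m n≤m)

2^[k+1]≡2^k+2^k : ∀ k → 2 ^ (k + 1) ≡ 2 ^ k + 2 ^ k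
2^[k+1]≡2^k+2^k k = begin
  2 ^ (k + 1)           ≡⟨ cong (2 ^_) (+-comm k 1) ⟩
  2 ^ k + (2 ^ k + 0)   ≡⟨ cong (2 ^ k +_) (+-identityʳ (2 ^ k)) ⟩
  2 ^ k + 2 ^ k         ∎
  where open ≡-Reasoning

span-< : ∀ {a d} c T → a ≤ d → d * c < T + a * c → (d ∸ a) * c < T
span-< {a} {d} c T a≤d d*c<T+a*c = begin-strict
  (d ∸ a) * c         ≡⟨ *-distribʳ-∸ c d a ⟩
  d * c ∸ a * c       <⟨ ∸-monoˡ-< d*c<T+a*c (*-monoˡ-≤ c a≤d) ⟩
  T + a * c ∸ a * c   ≡⟨ m+n∸n≡m T (a * c) ⟩
  T                   ∎
  where open ≤-Reasoning

window-gaps-< : ∀ {a b d} c T → a ≤ b → b ≤ d → d * c < T + a * c →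
  (b ∸ a) * c < T × (d ∸ b) * c < T
window-gaps-< {a} {b} {d} c T a≤b b≤d small =
  ≤-<-trans (*-monoˡ-≤ c (∸-monoˡ-≤ a b≤d)) span ,
  ≤-<-trans (*-monoˡ-≤ c (∸-monoʳ-≤ d a≤b)) span
  where span = span-< c T (≤-trans a≤b b≤d) small

sorted-unique⇒strict : ∀ {xs} → Linked _≤_ xs → Unique xs → Linked _<_ xs
sorted-unique⇒strict sorted unique = AllPairs⇒Linked
  (AllPairs.zipWith (uncurry ≤∧≢⇒<) (Linked⇒AllPairs ≤-trans sorted , unique))

-- The hypothesis is the telescoped window bound: it is preserved by discarding
-- x whenever the first window x < y < z is wide, and is contradictory once
-- only two elements remain.
close-triple : ∀ c T B .{{_ : NonZero c}} x y zs →
  Linked _<_ (x ∷ y ∷ zs) → All (_< B) (x ∷ y ∷ zs) →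
  (B + B) * c ≤ length zs * T + (x + y) * c →
  CloseTriple (_∈ x ∷ y ∷ zs) c T
close-triple c T B x y [] _ (x<B ∷ y<B ∷ _) wide =
  contradiction (*-cancelʳ-≤ (B + B) (x + y) c wide) (<⇒≱ (+-mono-< x<B y<B))
close-triple c T B x y (z ∷ zs) (x<y ∷ y<z ∷ increasing) (_ ∷ bounded) wide
  with z * c <? T + x * c
... | yes small =
  let gaps = window-gaps-< c T (<⇒≤ x<y) (<⇒≤ y<z) small in
  x , y , z , here refl , there (here refl) , there (there (here refl)) ,
  x<y , proj₁ gaps , y<z , proj₂ gaps
... | no large = CloseTriple-map there
  (close-triple c T B y z zs (y<z ∷ increasing) bounded wide′)
  where
  l = length zs
  shift : ∀ l T c x y → suc l * T + (x + y) * c ≡ l * T + (T + x * c) + y * c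
  shift = solve-∀
  merge : ∀ l T c y z → l * T + z * c + y * c ≡ l * T + (y + z) * c
  merge = solve-∀
  wide′ : (B + B) * c ≤ l * T + (y + z) * c
  wide′ = begin
    (B + B) * c                    ≤⟨ wide ⟩
    suc l * T + (x + y) * c        ≡⟨ shift l T c x y ⟩
    l * T + (T + x * c) + y * c    ≤⟨ +-monoˡ-≤ (y * c) (+-monoʳ-≤ (l * T) (≮⇒≥ large)) ⟩
    l * T + z * c + y * c          ≡⟨ merge l T c y z ⟩
    l * T + (y + z) * c            ∎
    where open ≤-Reasoning

strict-close-triple : ∀ T xs → Linked _<_ xs → All (λ m → T ≤ m + m × m < T) xs →
  3 ≤ length xs → CloseTriple (_∈ xs) (length xs ∸ 2) T
strict-close-triple T (_ ∷ _ ∷ []) _ _ (s≤s (s≤s ()))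
strict-close-triple T (x ∷ y ∷ z ∷ zs) increasing@(x<y ∷ _) ranges@((T≤x+x , _) ∷ _) _ =
  close-triple c T T x y (z ∷ zs) increasing (All.map proj₂ ranges) wide
  where
  c = length (z ∷ zs)
  wide : (T + T) * c ≤ c * T + (x + y) * c
  wide = begin
    (T + T) * c         ≡⟨ *-distribʳ-+ c T T ⟩
    T * c + T * c       ≡⟨ cong (_+ T * c) (*-comm T c) ⟩
    c * T + T * c       ≤⟨ +-monoʳ-≤ (c * T) (*-monoˡ-≤ c (≤-trans T≤x+x (+-monoʳ-≤ x (<⇒≤ x<y)))) ⟩
    c * T + (x + y) * c ∎
    where open ≤-Reasoning

proposition8 : {c ℓ₁ ℓ₂ : Level} (Alph : TotalOrder c ℓ₁ ℓ₂)
    (s : List (TotalOrder.Carrier Alph)) (k N : ℕ) →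
    CardO Alph s k N → 3 ≤ N →
    Σ ℕ λ m → Σ ℕ λ m′ → Σ ℕ λ m″ →
      InO Alph s k m × InO Alph s k m′ × InO Alph s k m″ ×
      (m < m′) × ((m′ ∸ m) * (N ∸ 2) < 2 ^ k) ×
      (m′ < m″) × ((m″ ∸ m′) * (N ∸ 2) < 2 ^ k)
proposition8 Alph s k N (L , unique , L≡O , |L|≡N) 3≤N =
  CloseTriple-map inO (subst (λ n → CloseTriple (_∈ sorted) (n ∸ 2) (2 ^ k)) |sorted|≡N triple)
  where
  sorted = sort L
  |sorted|≡N = trans (↭-length (sort-↭ L)) |L|≡N
  inO : ∀ {m} → m ∈ sorted → InO Alph s k m
  inO m∈ = Equivalence.to (L≡O _) (∈-resp-↭ (sort-↭ L) m∈)
  range : ∀ {m} → m ∈ sorted → 2 ^ k ≤ m + m × m < 2 ^ k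
  range m∈ with inO m∈
  ... | _ , lower , upper , _ = lower , half-< (subst (_ <_) (2^[k+1]≡2^k+2^k k) upper)
  increasing = sorted-unique⇒strict (sort-↗ L)
    (Unique-resp-↭ (setoid ℕ) (↭⇒↭ₛ (↭-sym (sort-↭ L))) unique)
  triple = strict-close-triple (2 ^ k) sorted increasing (All.tabulate range)
    (subst (3 ≤_) (sym |sorted|≡N) 3≤N)
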